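{- If $H$ is a hyperplane of $\Theta_n$, then either (1) $H = (Y - y_i) \cup x_i$ for some $i \in [n]$, or (2) $H = (Y - \{y_i, y_j\}) \cup x_k$ for distinct $i,j,k \in [n]$, or (3) $H = (X \cup Y) - \{y_i, y_j, y_k\}$ for distinct $i,j,k \in [n]$.
   Context: For an integer $n \ge 2$, $\Theta_n$ is the matroid on ground set $X \sqcup Y$, where $X = \{x_1, \dots, x_n\}$ and $Y = \{y_1, \dots, y_n\}$, whose bases are: $Y$; the sets $(Y - \{y_i\}) \cup \{x_j\}$ for distinct $i,j \in [n]$; and the sets $(Y - Y') \cup X'$ where $Y' \subseteq Y$, $X' \subseteq X$ and $|Y'| = |X'| = 2$. (Then $X$ is a modular flat of $\Theta_n$ and $\Theta_n|X \cong U_{2,n}$.) -}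

module Defs where

open import Data.Nat using (ℕ; suc; _+_; _≤_; _<_)
open import Data.Vec using (replicate; _++_)
open import Data.Fin using (Fin; _↑ˡ_; _↑ʳ_)
open import Data.Fin.Subset using (Subset; inside; outside; ⊤; ⁅_⁆; _∈_; _∉_; _∩_; _∪_; _-_; ∣_∣)
open import Data.Product using (Σ; ∃; _×_; _,_)
open import Data.Sum using (_⊎_)
open import Relation.Binary.PropositionalEquality using (_≡_; _≢_)
open import Relation.Nullary using (¬_)

HasRank : {m : ℕ} → (Subset m → Set) → Subset m → ℕ → Set
HasRank IsBasis S r =
  (Σ _ λ B → IsBasis B × ∣ B ∩ S ∣ ≡ r) ×
  (∀ B → IsBasis B → ∣ B ∩ S ∣ ≤ r)

IsFlat : {m : ℕ} → (Subset m → Set) → Subset m → Set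
IsFlat IsBasis F =
  ∀ e → e ∉ F → ∀ r r' → HasRank IsBasis F r → HasRank IsBasis (F ∪ ⁅ e ⁆) r' → r < r'

IsHyperplane : {m : ℕ} → (Subset m → Set) → Subset m → Set
IsHyperplane IsBasis H =
  IsFlat IsBasis H × Σ ℕ λ r → HasRank IsBasis ⊤ (suc r) × HasRank IsBasis H r

-- The matroid Θ_n on ground set X ⊔ Y, encoded as Fin (n + n):
-- x_j = j ↑ˡ n  (first copy), y_i = n ↑ʳ i  (second copy).

x : (n : ℕ) → Fin n → Fin (n + n)
x n j = j ↑ˡ n

y : (n : ℕ) → Fin n → Fin (n + n)
y n i = n ↑ʳ i

Ys : (n : ℕ) → Subset (n + n)
Ys n = replicate n outside ++ replicate n inside

IsBasisΘ : (n : ℕ) → Subset (n + n) → Set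
IsBasisΘ n B =
  B ≡ Ys n
  ⊎ (Σ (Fin n) λ i → Σ (Fin n) λ j → i ≢ j × B ≡ (Ys n - y n i) ∪ ⁅ x n j ⁆)
  ⊎ (Σ (Fin n) λ i → Σ (Fin n) λ i' → Σ (Fin n) λ j → Σ (Fin n) λ j' →
       i ≢ i' × j ≢ j' ×
       B ≡ ((Ys n - y n i) - y n i') ∪ (⁅ x n j ⁆ ∪ ⁅ x n j' ⁆))

-- A hyperplane H contains no basis, but H ∪ {e} contains one for every e ∉ H.
-- Every basis of Θ_n contains all of Y but at most two of its elements, and a
-- basis avoiding y_i contains some x_j with j ≠ i. Hence H misses between one
-- and three elements of Y. If it misses only y_i, then H contains x_i but no
-- other x_j (else (Y - y_i) ∪ x_j ⊆ H). If it misses y_i and y_j, then H ∪ y_i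
-- forces some x_k ∈ H with k ≠ j, and H ∪ y_j some x_k' ∈ H with k' ≠ i; two
-- distinct x's would complete the basis (Y - {y_i, y_j}) ∪ {x_k, x_k'}, so
-- H ∩ X = {x_k}. If it misses three, no H ∪ x_l is spanning, so X ⊆ H.
module Submission where

open import Defs
open import Data.Empty using (⊥; ⊥-elim)
open import Data.Fin using (Fin; _≟_; splitAt) renaming (zero to fzero; suc to fsuc)
open import Data.Fin.Properties using (any?; splitAt-↑ˡ; splitAt-↑ʳ; splitAt⁻¹-↑ˡ; splitAt⁻¹-↑ʳ; ↑ˡ-injective; ↑ʳ-injective)
open import Data.Fin.Subset using (Subset; ⊤; ⁅_⁆; _∪_; _∩_; _-_; _∈_; _∉_; _⊆_; ∣_∣; inside; outside)
open import Data.Fin.Subset.Properties using (_∈?_; ⊆-trans; ⊆-antisym; x∈⁅x⁆; x∈⁅y⁆⇒x≡y; x∈p∪q⁻; p⊆p∪q; q⊆p∪q; x∈p∩q⁺; x∈p∩q⁻; ∈⊤; p∩q⊆p; p─q⊆p; x∈p∧x≢y⇒x∈p-y; p⊆q⇒∣p∣≤∣q∣; p⊂q⇒∣p∣<∣q∣; p─⊥≡p; ∩-identityʳ; ∪-identityʳ; ∪-assoc; ∣⊤∣≡n)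
open import Data.Nat using (ℕ; suc; _+_; _≤_; _<_)
open import Data.Nat.Properties using (≤-trans; ≤-antisym; ≤-pred; <-irrefl)
open import Data.Product using (Σ; ∃; _×_; _,_; proj₁; proj₂)
open import Data.Sum using (_⊎_; inj₁; inj₂; [_,_]′)
open import Data.Vec using (_∷_; replicate; _++_; here; there)
open import Data.Vec.Properties using (lookup-++ˡ; lookup-++ʳ; lookup-replicate; []=⇒lookup; lookup⇒[]=)
open import Function using (_∘_; id)
open import Relation.Binary.Definitions using (DecidableEquality)
open import Relation.Binary.PropositionalEquality using (_≡_; _≢_; refl; sym; trans; cong; subst; ≢-sym; module ≡-Reasoning)
open import Relation.Nullary using (¬_; yes; no; contradiction)
open import Relation.Nullary.Decidable using (decidable-stable; ¬?; _×-dec_)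
open import Relation.Unary using (Decidable)

x∉p-x : ∀ {m} {p : Subset m} {a : Fin m} → a ∉ p - a
x∉p-x {p = _ ∷ _} {fzero} ()
x∉p-x {p = _ ∷ p} {fsuc a} (there a∈p-a) = x∉p-x a∈p-a

x∈p-y⁻ : ∀ {m} {p : Subset m} {a e : Fin m} → e ∈ p - a → e ∈ p × e ≢ a
x∈p-y⁻ {p = p} {a} e∈p-a = p─q⊆p p ⁅ a ⁆ e∈p-a , λ { refl → x∉p-x e∈p-a }

x∈p∪⁅y⁆⁻ : ∀ {m} {p : Subset m} {a e : Fin m} → e ∈ p ∪ ⁅ a ⁆ → e ≢ a → e ∈ p
x∈p∪⁅y⁆⁻ {p = p} {a} e∈p∪a e≢a = [ id , (λ e∈a → contradiction (x∈⁅y⁆⇒x≡y a e∈a) e≢a) ]′ (x∈p∪q⁻ p ⁅ a ⁆ e∈p∪a)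

x∉p∪⁅y⁆ : ∀ {m} {p : Subset m} {a e : Fin m} → e ∉ p → e ≢ a → e ∉ p ∪ ⁅ a ⁆
x∉p∪⁅y⁆ e∉p e≢a e∈p∪a = e∉p (x∈p∪⁅y⁆⁻ e∈p∪a e≢a)

∪-⊆ : ∀ {m} {p q r : Subset m} → p ⊆ r → q ⊆ r → p ∪ q ⊆ r
∪-⊆ {p = p} {q} p⊆r q⊆r e∈p∪q = [ p⊆r , q⊆r ]′ (x∈p∪q⁻ p q e∈p∪q)

⁅⁆-⊆ : ∀ {m} {p : Subset m} {a : Fin m} → a ∈ p → ⁅ a ⁆ ⊆ p
⁅⁆-⊆ {a = a} a∈p e∈⁅a⁆ = subst (_∈ _) (sym (x∈⁅y⁆⇒x≡y a e∈⁅a⁆)) a∈p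

∣p∩q∣<∣p∣ : ∀ {m} {p q : Subset m} → ¬ p ⊆ q → ∣ p ∩ q ∣ < ∣ p ∣
∣p∩q∣<∣p∣ {p = p} {q} p⊈q with any? (λ e → e ∈? p ×-dec ¬? (e ∈? q))
... | yes (e , e∈p , e∉q) = p⊂q⇒∣p∣<∣q∣ (p∩q⊆p p q , e , e∈p , e∉q ∘ proj₂ ∘ x∈p∩q⁻ p q)
... | no ∄e = contradiction (λ {e} e∈p → decidable-stable (e ∈? q) (λ e∉q → ∄e (e , e∈p , e∉q))) p⊈q

∣p∪⁅x⁆∣≡1+∣p∣ : ∀ {m} {p : Subset m} {a : Fin m} → a ∉ p → ∣ p ∪ ⁅ a ⁆ ∣ ≡ suc ∣ p ∣
∣p∪⁅x⁆∣≡1+∣p∣ {p = outside ∷ p} {fzero}  a∉p = cong (suc ∘ ∣_∣) (∪-identityʳ p)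
∣p∪⁅x⁆∣≡1+∣p∣ {p = inside  ∷ p} {fzero}  a∉p = contradiction here a∉p
∣p∪⁅x⁆∣≡1+∣p∣ {p = outside ∷ p} {fsuc a} a∉p = ∣p∪⁅x⁆∣≡1+∣p∣ (a∉p ∘ there)
∣p∪⁅x⁆∣≡1+∣p∣ {p = inside  ∷ p} {fsuc a} a∉p = cong suc (∣p∪⁅x⁆∣≡1+∣p∣ (a∉p ∘ there))

∣p∣≡1+∣p-x∣ : ∀ {m} {p : Subset m} {a : Fin m} → a ∈ p → ∣ p ∣ ≡ suc ∣ p - a ∣
∣p∣≡1+∣p-x∣ {p = inside  ∷ p} here = cong (suc ∘ ∣_∣) (sym (p─⊥≡p p))
∣p∣≡1+∣p-x∣ {p = outside ∷ p} (there a∈p) = ∣p∣≡1+∣p-x∣ a∈p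
∣p∣≡1+∣p-x∣ {p = inside  ∷ p} (there a∈p) = cong suc (∣p∣≡1+∣p-x∣ a∈p)

∣⊥++p∣≡∣p∣ : ∀ k {m} (p : Subset m) → ∣ replicate k outside ++ p ∣ ≡ ∣ p ∣
∣⊥++p∣≡∣p∣ 0       p = refl
∣⊥++p∣≡∣p∣ (suc k) p = ∣⊥++p∣≡∣p∣ k p

module _ {A : Set} (_≟ᴬ_ : DecidableEquality A) where

  three-distinct-avoid-two : ∀ {i j k : A} → i ≢ j → i ≢ k → j ≢ k → (a b : A) →
                             (i ≢ a × i ≢ b) ⊎ (j ≢ a × j ≢ b) ⊎ (k ≢ a × k ≢ b)
  three-distinct-avoid-two {i} {j} {k} i≢j i≢k j≢k a b with i ≟ᴬ a | i ≟ᴬ b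
  ... | no i≢a   | no i≢b = inj₁ (i≢a , i≢b)
  ... | yes refl | _ with j ≟ᴬ b
  ...   | no j≢b   = inj₂ (inj₁ (≢-sym i≢j , j≢b))
  ...   | yes refl = inj₂ (inj₂ (≢-sym i≢k , ≢-sym j≢k))
  three-distinct-avoid-two {i} {j} {k} i≢j i≢k j≢k a b | no _ | yes refl with j ≟ᴬ a
  ...   | no j≢a   = inj₂ (inj₁ (j≢a , ≢-sym i≢j))
  ...   | yes refl = inj₂ (inj₂ (≢-sym j≢k , ≢-sym i≢k))

Spanning : {m : ℕ} → (Subset m → Set) → Subset m → Set
Spanning IsBasis S = ∃ λ B → IsBasis B × B ⊆ S

module Hyperplane {m k : ℕ} {IsBasis : Subset m → Set}
  (∣basis∣≡k : ∀ {B} → IsBasis B → ∣ B ∣ ≡ k)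
  {H : Subset m} (hyperplane : IsHyperplane IsBasis H) where

  private
    r : ℕ
    r = proj₁ (proj₂ hyperplane)

    rank-H : HasRank IsBasis H r
    rank-H = proj₂ (proj₂ (proj₂ hyperplane))

    1+r≡k : suc r ≡ k
    1+r≡k with proj₁ (proj₁ (proj₂ (proj₂ hyperplane)))
    ... | B , B-basis , ∣B∩⊤∣≡1+r =
      trans (sym ∣B∩⊤∣≡1+r) (trans (cong ∣_∣ (∩-identityʳ B)) (∣basis∣≡k B-basis))

  ¬spanning : ¬ Spanning IsBasis H
  ¬spanning (B , B-basis , B⊆H) = <-irrefl refl (≤-trans ∣B∣≤∣B∩H∣ (proj₂ rank-H B B-basis))
    where
    ∣B∣≤∣B∩H∣ : suc r ≤ ∣ B ∩ H ∣
    ∣B∣≤∣B∩H∣ = subst (_≤ ∣ B ∩ H ∣) (trans (∣basis∣≡k B-basis) (sym 1+r≡k))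
                  (p⊆q⇒∣p∣≤∣q∣ (λ e∈B → x∈p∩q⁺ (e∈B , B⊆H e∈B)))

  -- Only doubly negated, as bases cannot be searched for; H ∪ {e} would
  -- otherwise have the same rank as H.
  ¬¬spanning-∪ : ∀ {e} → e ∉ H → ¬ ¬ Spanning IsBasis (H ∪ ⁅ e ⁆)
  ¬¬spanning-∪ {e} e∉H ¬spanning-S = <-irrefl refl (proj₁ hyperplane e e∉H r r rank-H rank-S)
    where
    S : Subset m
    S = H ∪ ⁅ e ⁆

    ∣B∩S∣≤r : ∀ B → IsBasis B → ∣ B ∩ S ∣ ≤ r
    ∣B∩S∣≤r B B-basis = ≤-pred (subst (∣ B ∩ S ∣ <_) (trans (∣basis∣≡k B-basis) (sym 1+r≡k))
                        (∣p∩q∣<∣p∣ (λ B⊆S → ¬spanning-S (B , B-basis , B⊆S))))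

    rank-S : HasRank IsBasis S r
    rank-S with proj₁ rank-H
    ... | B , B-basis , ∣B∩H∣≡r = (B , B-basis , ≤-antisym (∣B∩S∣≤r B B-basis) r≤∣B∩S∣) , ∣B∩S∣≤r
      where
      r≤∣B∩S∣ : r ≤ ∣ B ∩ S ∣
      r≤∣B∩S∣ = subst (_≤ ∣ B ∩ S ∣) ∣B∩H∣≡r (p⊆q⇒∣p∣≤∣q∣ λ {a} a∈B∩H →
                  let a∈B , a∈H = x∈p∩q⁻ B H a∈B∩H in x∈p∩q⁺ (a∈B , p⊆p∪q ⁅ e ⁆ a∈H))

data Exceptions {m : ℕ} (P : Fin m → Set) : Set where
  none  : (∀ l → P l) → Exceptions P
  one   : ∀ {i} → ¬ P i → (∀ l → l ≢ i → P l) → Exceptions P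
  two   : ∀ {i j} → i ≢ j → ¬ P i → ¬ P j → (∀ l → l ≢ i → l ≢ j → P l) → Exceptions P
  three : ∀ {i j k} → i ≢ j → i ≢ k → j ≢ k → ¬ P i → ¬ P j → ¬ P k →
          (∀ l → l ≢ i → l ≢ j → l ≢ k → P l) → Exceptions P
  many  : ∀ {i j k l} → i ≢ j → i ≢ k → i ≢ l → j ≢ k → j ≢ l → k ≢ l →
          ¬ P i → ¬ P j → ¬ P k → ¬ P l → Exceptions P

exceptions : ∀ {m} {P : Fin m → Set} → Decidable P → Exceptions P
exceptions {P = P} P? with any? (¬? ∘ P?)
... | no ∄i = none λ l → decidable-stable (P? l) λ ¬Pl → ∄i (l , ¬Pl)
... | yes (i , ¬Pi) with any? (λ l → ¬? (l ≟ i) ×-dec ¬? (P? l))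
...   | no ∄j = one ¬Pi λ l l≢i → decidable-stable (P? l) λ ¬Pl → ∄j (l , l≢i , ¬Pl)
...   | yes (j , j≢i , ¬Pj) with any? (λ l → ¬? (l ≟ i) ×-dec ¬? (l ≟ j) ×-dec ¬? (P? l))
...     | no ∄k = two (≢-sym j≢i) ¬Pi ¬Pj λ l l≢i l≢j →
                   decidable-stable (P? l) λ ¬Pl → ∄k (l , l≢i , l≢j , ¬Pl)
...     | yes (k , k≢i , k≢j , ¬Pk) with any? (λ l → ¬? (l ≟ i) ×-dec ¬? (l ≟ j) ×-dec ¬? (l ≟ k) ×-dec ¬? (P? l))
...       | no ∄l = three (≢-sym j≢i) (≢-sym k≢i) (≢-sym k≢j) ¬Pi ¬Pj ¬Pk λ l l≢i l≢j l≢k →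
                     decidable-stable (P? l) λ ¬Pl → ∄l (l , l≢i , l≢j , l≢k , ¬Pl)
...       | yes (l , l≢i , l≢j , l≢k , ¬Pl) =
            many (≢-sym j≢i) (≢-sym k≢i) (≢-sym l≢i) (≢-sym k≢j) (≢-sym l≢j) (≢-sym l≢k) ¬Pi ¬Pj ¬Pk ¬Pl

data XorY (n : ℕ) : Fin (n + n) → Set where
  isX : ∀ j → XorY n (x n j)
  isY : ∀ i → XorY n (y n i)

module _ {n : ℕ} where

  x-or-y : (e : Fin (n + n)) → XorY n e
  x-or-y e with splitAt n e in eq
  ... | inj₁ j = subst (XorY n) (splitAt⁻¹-↑ˡ eq) (isX j)
  ... | inj₂ i = subst (XorY n) (splitAt⁻¹-↑ʳ eq) (isY i)

  x≢y : ∀ {j i} → x n j ≢ y n i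
  x≢y {j} {i} eq with trans (sym (splitAt-↑ˡ n j n)) (trans (cong (splitAt n) eq) (splitAt-↑ʳ n n i))
  ... | ()

  x-injective : ∀ {j j'} → x n j ≡ x n j' → j ≡ j'
  x-injective = ↑ˡ-injective n _ _

  y-injective : ∀ {i i'} → y n i ≡ y n i' → i ≡ i'
  y-injective = ↑ʳ-injective n _ _

  y∈Ys : ∀ {i} → y n i ∈ Ys n
  y∈Ys {i} = lookup⇒[]= (y n i) (Ys n)
    (trans (lookup-++ʳ (replicate n outside) (replicate n inside) i) (lookup-replicate i inside))

  x∉Ys : ∀ {j} → x n j ∉ Ys n
  x∉Ys {j} xj∈Ys with trans (sym ([]=⇒lookup xj∈Ys))
    (trans (lookup-++ˡ (replicate n outside) (replicate n inside) j) (lookup-replicate j outside))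
  ... | ()

  ∣Ys∣≡n : ∣ Ys n ∣ ≡ n
  ∣Ys∣≡n = trans (∣⊥++p∣≡∣p∣ n (replicate n inside)) (∣⊤∣≡n n)

  y∈-y⁺ : ∀ {p : Subset (n + n)} {k i} → y n k ∈ p → k ≢ i → y n k ∈ p - y n i
  y∈-y⁺ yk∈p k≢i = x∈p∧x≢y⇒x∈p-y yk∈p (k≢i ∘ y-injective)

  y∈-y⁻ : ∀ {p : Subset (n + n)} {k i} → y n k ∈ p - y n i → y n k ∈ p × k ≢ i
  y∈-y⁻ yk∈p-yi = let yk∈p , yk≢yi = x∈p-y⁻ yk∈p-yi in yk∈p , yk≢yi ∘ cong (y n)

  x∈-y⁺ : ∀ {p : Subset (n + n)} {j i} → x n j ∈ p → x n j ∈ p - y n i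
  x∈-y⁺ xj∈p = x∈p∧x≢y⇒x∈p-y xj∈p x≢y

  x∉⊆Ys : ∀ {p : Subset (n + n)} {j} → p ⊆ Ys n → x n j ∉ p
  x∉⊆Ys p⊆Ys = x∉Ys ∘ p⊆Ys

  ∣basis∣≡n : ∀ {B} → IsBasisΘ n B → ∣ B ∣ ≡ n
  ∣basis∣≡n (inj₁ refl) = ∣Ys∣≡n
  ∣basis∣≡n (inj₂ (inj₁ (i , j , _ , refl))) = begin
    ∣ (Ys n - y n i) ∪ ⁅ x n j ⁆ ∣  ≡⟨ ∣p∪⁅x⁆∣≡1+∣p∣ {p = Ys n - y n i} (x∉⊆Ys (p─q⊆p _ _)) ⟩
    suc ∣ Ys n - y n i ∣           ≡⟨ sym (∣p∣≡1+∣p-x∣ y∈Ys) ⟩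
    ∣ Ys n ∣                       ≡⟨ ∣Ys∣≡n ⟩
    n                              ∎
    where open ≡-Reasoning
  ∣basis∣≡n (inj₂ (inj₂ (i , i' , j , j' , i≢i' , j≢j' , refl))) = begin
    ∣ P ∪ (⁅ x n j ⁆ ∪ ⁅ x n j' ⁆) ∣  ≡⟨ cong ∣_∣ (sym (∪-assoc P ⁅ x n j ⁆ ⁅ x n j' ⁆)) ⟩
    ∣ (P ∪ ⁅ x n j ⁆) ∪ ⁅ x n j' ⁆ ∣  ≡⟨ ∣p∪⁅x⁆∣≡1+∣p∣ {p = P ∪ ⁅ x n j ⁆} xj'∉P∪xj ⟩
    suc ∣ P ∪ ⁅ x n j ⁆ ∣             ≡⟨ cong suc (∣p∪⁅x⁆∣≡1+∣p∣ {p = P} (x∉⊆Ys P⊆Ys)) ⟩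
    suc (suc ∣ P ∣)                  ≡⟨ cong suc (sym (∣p∣≡1+∣p-x∣ (y∈-y⁺ y∈Ys (≢-sym i≢i')))) ⟩
    suc ∣ Ys n - y n i ∣             ≡⟨ sym (∣p∣≡1+∣p-x∣ y∈Ys) ⟩
    ∣ Ys n ∣                         ≡⟨ ∣Ys∣≡n ⟩
    n                                ∎
    where
    open ≡-Reasoning
    P : Subset (n + n)
    P = (Ys n - y n i) - y n i'
    P⊆Ys : P ⊆ Ys n
    P⊆Ys = ⊆-trans (p─q⊆p _ _) (p─q⊆p _ _)
    xj'∉P∪xj : x n j' ∉ P ∪ ⁅ x n j ⁆
    xj'∉P∪xj xj'∈ = x∉⊆Ys P⊆Ys (x∈p∪⁅y⁆⁻ xj'∈ (≢-sym j≢j' ∘ x-injective))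

  Ys⊆ : ∀ {S} → (∀ k → y n k ∈ S) → Ys n ⊆ S
  Ys⊆ ys∈S {e} e∈Ys with x-or-y e
  ... | isX j = contradiction e∈Ys x∉Ys
  ... | isY k = ys∈S k

  Ys-y⊆ : ∀ {S i} → (∀ k → k ≢ i → y n k ∈ S) → Ys n - y n i ⊆ S
  Ys-y⊆ ys∈S {e} e∈P with x-or-y e
  ... | isX j = contradiction (p─q⊆p _ _ e∈P) x∉Ys
  ... | isY k = ys∈S k (proj₂ (y∈-y⁻ e∈P))

  Ys-y-y⊆ : ∀ {S i i'} → (∀ k → k ≢ i → k ≢ i' → y n k ∈ S) → (Ys n - y n i) - y n i' ⊆ S
  Ys-y-y⊆ ys∈S {e} e∈P with x-or-y e
  ... | isX j = contradiction (p─q⊆p _ _ (p─q⊆p _ _ e∈P)) x∉Ys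
  ... | isY k = let yk∈Ys-yi , k≢i' = y∈-y⁻ e∈P in ys∈S k (proj₂ (y∈-y⁻ yk∈Ys-yi)) k≢i'

  ⊤-y-y-y⊆ : ∀ {S i j k} → (∀ l → x n l ∈ S) → (∀ l → l ≢ i → l ≢ j → l ≢ k → y n l ∈ S) →
             ((⊤ - y n i) - y n j) - y n k ⊆ S
  ⊤-y-y-y⊆ xs∈S ys∈S {e} e∈P with x-or-y e
  ... | isX l = xs∈S l
  ... | isY l = let yl∈⊤-yi-yj , l≢k = y∈-y⁻ e∈P
                    yl∈⊤-yi    , l≢j = y∈-y⁻ yl∈⊤-yi-yj
                in ys∈S l (proj₂ (y∈-y⁻ yl∈⊤-yi)) l≢j l≢k

  ¬spanning-y∉-x∉ : ∀ {S i} → y n i ∉ S → (∀ j → j ≢ i → x n j ∉ S) → ¬ Spanning (IsBasisΘ n) S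
  ¬spanning-y∉-x∉ yi∉S xs∉S (_ , inj₁ refl , B⊆S) = yi∉S (B⊆S y∈Ys)
  ¬spanning-y∉-x∉ {i = i} yi∉S xs∉S (_ , inj₂ (inj₁ (i' , j , i'≢j , refl)) , B⊆S) with i ≟ i'
  ... | yes refl = xs∉S j (≢-sym i'≢j) (B⊆S (q⊆p∪q _ _ (x∈⁅x⁆ _)))
  ... | no i≢i' = yi∉S (B⊆S (p⊆p∪q _ (y∈-y⁺ y∈Ys i≢i')))
  ¬spanning-y∉-x∉ {i = i} yi∉S xs∉S (_ , inj₂ (inj₂ (_ , _ , j , j' , _ , j≢j' , refl)) , B⊆S) with j ≟ i
  ... | yes refl = xs∉S j' (≢-sym j≢j') (B⊆S (q⊆p∪q _ _ (q⊆p∪q _ _ (x∈⁅x⁆ _))))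
  ... | no j≢i = xs∉S j j≢i (B⊆S (q⊆p∪q _ _ (p⊆p∪q _ (x∈⁅x⁆ _))))

  ¬spanning-three-y∉ : ∀ {S i j k} → i ≢ j → i ≢ k → j ≢ k →
                       y n i ∉ S → y n j ∉ S → y n k ∉ S → ¬ Spanning (IsBasisΘ n) S
  ¬spanning-three-y∉ {S} {i} {j} {k} i≢j i≢k j≢k yi∉S yj∉S yk∉S (B , B-basis , B⊆S) =
    contains-all-but-two B-basis
    where
    all-but-two-y∉ : ∀ a b → ¬ (∀ l → l ≢ a → l ≢ b → y n l ∈ S)
    all-but-two-y∉ a b ys∈S with three-distinct-avoid-two _≟_ i≢j i≢k j≢k a b
    ... | inj₁ (i≢a , i≢b)        = yi∉S (ys∈S i i≢a i≢b)
    ... | inj₂ (inj₁ (j≢a , j≢b)) = yj∉S (ys∈S j j≢a j≢b)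
    ... | inj₂ (inj₂ (k≢a , k≢b)) = yk∉S (ys∈S k k≢a k≢b)

    contains-all-but-two : ¬ IsBasisΘ n B
    contains-all-but-two (inj₁ refl) = all-but-two-y∉ i i λ _ _ _ → B⊆S y∈Ys
    contains-all-but-two (inj₂ (inj₁ (a , _ , _ , refl))) =
      all-but-two-y∉ a a λ _ l≢a _ → B⊆S (p⊆p∪q _ (y∈-y⁺ y∈Ys l≢a))
    contains-all-but-two (inj₂ (inj₂ (a , b , _ , _ , _ , _ , refl))) =
      all-but-two-y∉ a b λ _ l≢a l≢b → B⊆S (p⊆p∪q _ (y∈-y⁺ (y∈-y⁺ y∈Ys l≢a) l≢b))

  module Classification {H : Subset (n + n)} (hyperplane : IsHyperplane (IsBasisΘ n) H) where

    open Hyperplane ∣basis∣≡n hyperplane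

    x∈H-besides : ∀ {a b} → a ≢ b → y n a ∉ H → y n b ∉ H → ∃ λ k → k ≢ b × x n k ∈ H
    x∈H-besides {a} {b} a≢b ya∉H yb∉H =
      decidable-stable (any? λ k → ¬? (k ≟ b) ×-dec x n k ∈? H) λ ∄k → ¬¬spanning-∪ ya∉H
        (¬spanning-y∉-x∉ (x∉p∪⁅y⁆ yb∉H (≢-sym a≢b ∘ y-injective))
           λ k k≢b → x∉p∪⁅y⁆ (λ xk∈H → ∄k (k , k≢b , xk∈H)) x≢y)

    ¬all-y∈H : ¬ (∀ k → y n k ∈ H)
    ¬all-y∈H ys∈H = ¬spanning (Ys n , inj₁ refl , Ys⊆ ys∈H)

    one-y∉H : ∀ {i} → y n i ∉ H → (∀ k → k ≢ i → y n k ∈ H) → H ≡ (Ys n - y n i) ∪ ⁅ x n i ⁆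
    one-y∉H {i} yi∉H ys∈H = ⊆-antisym H⊆T (∪-⊆ (Ys-y⊆ ys∈H) (⁅⁆-⊆ xi∈H))
      where
      xs∉H : ∀ j → j ≢ i → x n j ∉ H
      xs∉H j j≢i xj∈H =
        ¬spanning (_ , inj₂ (inj₁ (i , j , ≢-sym j≢i , refl)) , ∪-⊆ (Ys-y⊆ ys∈H) (⁅⁆-⊆ xj∈H))

      xi∈H : x n i ∈ H
      xi∈H = decidable-stable (x n i ∈? H) λ xi∉H → ¬¬spanning-∪ xi∉H
        (¬spanning-y∉-x∉ (x∉p∪⁅y⁆ yi∉H (x≢y ∘ sym)) λ j j≢i → x∉p∪⁅y⁆ (xs∉H j j≢i) (j≢i ∘ x-injective))

      H⊆T : H ⊆ (Ys n - y n i) ∪ ⁅ x n i ⁆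
      H⊆T {e} e∈H with x-or-y e
      ... | isY k = p⊆p∪q _ (y∈-y⁺ y∈Ys λ { refl → yi∉H e∈H })
      ... | isX j with j ≟ i
      ...   | yes refl = q⊆p∪q _ _ (x∈⁅x⁆ _)
      ...   | no j≢i   = contradiction e∈H (xs∉H j j≢i)

    module _ {i j : Fin n} (i≢j : i ≢ j) (yi∉H : y n i ∉ H) (yj∉H : y n j ∉ H)
             (ys∈H : ∀ l → l ≢ i → l ≢ j → y n l ∈ H) where

      private
        ¬two-x∈H : ∀ {a b} → a ≢ b → x n a ∈ H → x n b ∈ H → ⊥
        ¬two-x∈H a≢b xa∈H xb∈H = ¬spanning (_ , inj₂ (inj₂ (i , j , _ , _ , i≢j , a≢b , refl)) ,
                                   ∪-⊆ (Ys-y-y⊆ ys∈H) (∪-⊆ (⁅⁆-⊆ xa∈H) (⁅⁆-⊆ xb∈H)))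

      two-y∉H : ∃ λ k → i ≢ k × j ≢ k × H ≡ ((Ys n - y n i) - y n j) ∪ ⁅ x n k ⁆
      two-y∉H with x∈H-besides i≢j yi∉H yj∉H | x∈H-besides (≢-sym i≢j) yj∉H yi∉H
      ... | k , k≢j , xk∈H | k' , k'≢i , xk'∈H with k ≟ k'
      ...   | no k≢k' = ⊥-elim (¬two-x∈H k≢k' xk∈H xk'∈H)
      ...   | yes refl = k , ≢-sym k'≢i , ≢-sym k≢j , ⊆-antisym H⊆T (∪-⊆ (Ys-y-y⊆ ys∈H) (⁅⁆-⊆ xk∈H))
        where
        H⊆T : H ⊆ ((Ys n - y n i) - y n j) ∪ ⁅ x n k ⁆
        H⊆T {e} e∈H with x-or-y e
        ... | isY l = p⊆p∪q _ (y∈-y⁺ (y∈-y⁺ y∈Ys λ { refl → yi∉H e∈H }) λ { refl → yj∉H e∈H })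
        ... | isX l with l ≟ k
        ...   | yes refl = q⊆p∪q _ _ (x∈⁅x⁆ _)
        ...   | no l≢k   = ⊥-elim (¬two-x∈H l≢k e∈H xk∈H)

    three-y∉H : ∀ {i j k} → i ≢ j → i ≢ k → j ≢ k → y n i ∉ H → y n j ∉ H → y n k ∉ H →
                (∀ l → l ≢ i → l ≢ j → l ≢ k → y n l ∈ H) → H ≡ ((⊤ - y n i) - y n j) - y n k
    three-y∉H {i} {j} {k} i≢j i≢k j≢k yi∉H yj∉H yk∉H ys∈H = ⊆-antisym H⊆T (⊤-y-y-y⊆ xs∈H ys∈H)
      where
      xs∈H : ∀ l → x n l ∈ H
      xs∈H l = decidable-stable (x n l ∈? H) λ xl∉H → ¬¬spanning-∪ xl∉H
        (¬spanning-three-y∉ i≢j i≢k j≢k (y∉H∪xl yi∉H) (y∉H∪xl yj∉H) (y∉H∪xl yk∉H))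
        where
        y∉H∪xl : ∀ {a} → y n a ∉ H → y n a ∉ H ∪ ⁅ x n l ⁆
        y∉H∪xl ya∉H = x∉p∪⁅y⁆ ya∉H (x≢y ∘ sym)

      H⊆T : H ⊆ ((⊤ - y n i) - y n j) - y n k
      H⊆T {e} e∈H with x-or-y e
      ... | isX l = x∈-y⁺ (x∈-y⁺ (x∈-y⁺ ∈⊤))
      ... | isY l = y∈-y⁺ (y∈-y⁺ (y∈-y⁺ ∈⊤ λ { refl → yi∉H e∈H }) λ { refl → yj∉H e∈H }) λ { refl → yk∉H e∈H }

    ¬four-y∉H : ∀ {i j k l} → i ≢ j → i ≢ k → i ≢ l → j ≢ k → j ≢ l → k ≢ l →
                y n i ∉ H → y n j ∉ H → y n k ∉ H → y n l ∉ H → ⊥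
    ¬four-y∉H {i} i≢j i≢k i≢l j≢k j≢l k≢l yi∉H yj∉H yk∉H yl∉H = ¬¬spanning-∪ yi∉H
      (¬spanning-three-y∉ j≢k j≢l k≢l (y∉H∪yi i≢j yj∉H) (y∉H∪yi i≢k yk∉H) (y∉H∪yi i≢l yl∉H))
      where
      y∉H∪yi : ∀ {a} → i ≢ a → y n a ∉ H → y n a ∉ H ∪ ⁅ y n i ⁆
      y∉H∪yi i≢a ya∉H = x∉p∪⁅y⁆ ya∉H (≢-sym i≢a ∘ y-injective)

open Classification

proposition5p1 : (n : ℕ) → 2 ≤ n → (H : Subset (n + n)) →
    IsHyperplane (IsBasisΘ n) H →
    (Σ (Fin n) λ i → H ≡ (Ys n - y n i) ∪ ⁅ x n i ⁆)
    ⊎ (Σ (Fin n) λ i → Σ (Fin n) λ j → Σ (Fin n) λ k →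
    i ≢ j × i ≢ k × j ≢ k × H ≡ ((Ys n - y n i) - y n j) ∪ ⁅ x n k ⁆)
    ⊎ (Σ (Fin n) λ i → Σ (Fin n) λ j → Σ (Fin n) λ k →
    i ≢ j × i ≢ k × j ≢ k × H ≡ ((⊤ - y n i) - y n j) - y n k)
proposition5p1 n _ H hyperplane with exceptions (λ i → y n i ∈? H)
... | none ys∈H = ⊥-elim (¬all-y∈H hyperplane ys∈H)
... | one yi∉H ys∈H = inj₁ (_ , one-y∉H hyperplane yi∉H ys∈H)
... | two i≢j yi∉H yj∉H ys∈H =
  let k , i≢k , j≢k , H≡T = two-y∉H hyperplane i≢j yi∉H yj∉H ys∈H
  in inj₂ (inj₁ (_ , _ , k , i≢j , i≢k , j≢k , H≡T))
... | three i≢j i≢k j≢k yi∉H yj∉H yk∉H ys∈H =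
  inj₂ (inj₂ (_ , _ , _ , i≢j , i≢k , j≢k , three-y∉H hyperplane i≢j i≢k j≢k yi∉H yj∉H yk∉H ys∈H))
... | many i≢j i≢k i≢l j≢k j≢l k≢l yi∉H yj∉H yk∉H yl∉H =
  ⊥-elim (¬four-y∉H hyperplane i≢j i≢k i≢l j≢k j≢l k≢l yi∉H yj∉H yk∉H yl∉H)
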